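{- Let $H$ be a finite simple undirected graph with $|V(H)|\ge 2$ and diameter at most $2$, and let $G$ be the graph constructed from $H$ as described in the context. If $M$ is a monitoring edge-geodetic set of $G$ with $|M| = k+|V(H)|+1$ (for some integer $k$), then $M\cap V(H)$ is a vertex cover of $H$ of size at most $k$.
   Context: An edge $\{a,b\}$ of a graph $G$ is monitored by a pair of vertices $\{x,y\}$ if $\{a,b\}$ lies on every shortest path from $x$ to $y$ in $G$. A monitoring edge-geodetic set (MEG-set) of $G$ is a set $M\subseteq V(G)$ such that every edge of $G$ is monitored by some pair $\{x,y\}$ with $x,y\in M$. Construction of $G$ from $H$: for each $v\in V(H)$ add two new vertices $v'$ and $v''$ and the edges $\{v,v'\}$ and $\{v',v''\}$; let $L'=\{v' : v\in V(H)\}$ and $L''=\{v'' : v\in V(H)\}$. Then add two further new vertices $v_*$ and $v_*'$, the edge $\{v_*,v_*'\}$, and the edges $\{v_*,v'\}$ for all $v'\in L'$. Thus $V(G)=V(H)\cup L'\cup L''\cup\{v_*,v_*'\}$. -}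

module Defs where

open import Data.Nat using (ℕ; zero; suc; _<_; _≤_)
open import Data.Fin using (Fin)
open import Data.List using (List; []; _∷_)
open import Data.List.Membership.Propositional using (_∈_)
open import Data.Product using (_×_; ∃; ∃-syntax)
open import Data.Sum using (_⊎_)
open import Relation.Nullary using (¬_; Dec)
open import Relation.Binary.PropositionalEquality using (_≡_)

record SimpleGraph (n : ℕ) : Set₁ where
  field
    Adj        : Fin n → Fin n → Set
    Adj-sym    : ∀ {u v} → Adj u v → Adj v u
    Adj-irrefl : ∀ {u} → ¬ Adj u u
    Adj-dec    : ∀ u v → Dec (Adj u v)
open SimpleGraph public

data Walk {V : Set} (E : V → V → Set) : V → V → ℕ → Set where
  []  : ∀ {x} → Walk E x x zero
  _∷_ : ∀ {x y z ℓ} → E x y → Walk E y z ℓ → Walk E x z (suc ℓ)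

data OnWalk {V : Set} {E : V → V → Set} (a b : V) :
            ∀ {x y ℓ} → Walk E x y ℓ → Set where
  here  : ∀ {x y z ℓ} {e : E x y} {w : Walk E y z ℓ} →
          ((x ≡ a × y ≡ b) ⊎ (x ≡ b × y ≡ a)) → OnWalk a b (e ∷ w)
  there : ∀ {x y z ℓ} {e : E x y} {w : Walk E y z ℓ} →
          OnWalk a b w → OnWalk a b (e ∷ w)

IsShortest : {V : Set} {E : V → V → Set} {x y : V} {ℓ : ℕ} → Walk E x y ℓ → Set
IsShortest {E = E} {x} {y} {ℓ} _ = ∀ m → m < ℓ → ¬ Walk E x y m

Monitors : {V : Set} (E : V → V → Set) (x y a b : V) → Set
Monitors E x y a b = ∀ ℓ (w : Walk E x y ℓ) → IsShortest w → OnWalk a b w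

IsMEG : {V : Set} (E : V → V → Set) (M : List V) → Set
IsMEG {V} E M = ∀ a b → E a b → ∃[ x ] ∃[ y ] (x ∈ M × y ∈ M × Monitors E x y a b)

DiamAtMost2 : {n : ℕ} → SimpleGraph n → Set
DiamAtMost2 {n} H = ∀ (u v : Fin n) → ∃[ ℓ ] (ℓ ≤ 2 × Walk (Adj H) u v ℓ)

-- orig v ∈ V(H), l1 v = v', l2 v = v'', star = v_*, star' = v_*'
data GV (n : ℕ) : Set where
  orig l1 l2   : Fin n → GV n
  star star'   : GV n

data GAdj {n : ℕ} (H : SimpleGraph n) : GV n → GV n → Set where
  h-h       : ∀ {u v} → Adj H u v → GAdj H (orig u) (orig v)
  h-l1      : ∀ {v} → GAdj H (orig v) (l1 v)
  l1-h      : ∀ {v} → GAdj H (l1 v) (orig v)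
  l1-l2     : ∀ {v} → GAdj H (l1 v) (l2 v)
  l2-l1     : ∀ {v} → GAdj H (l2 v) (l1 v)
  star-star' : GAdj H star star'
  star'-star : GAdj H star' star
  star-l1   : ∀ {v} → GAdj H star (l1 v)
  l1-star   : ∀ {v} → GAdj H (l1 v) star

-- M ∩ V(H), as a list of vertices of H (in the order they occur in M)
origs : {n : ℕ} → List (GV n) → List (Fin n)
origs []              = []
origs (orig v ∷ xs)   = v ∷ origs xs
origs (l1 _ ∷ xs)     = origs xs
origs (l2 _ ∷ xs)     = origs xs
origs (star ∷ xs)     = origs xs
origs (star' ∷ xs)    = origs xs

-- Since H has diameter at most 2, the distances in G form a small explicit table. For every
-- pair x, y of vertices of G there is a shortest x–y path that uses an edge uv of H only if
-- x or y is u or v, a pendant edge v′v″ only if v″ ∈ {x, y}, and the edge v_*v_*′ only if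
-- v_*′ ∈ {x, y}. A pair monitoring such an edge must therefore contain one of these guards,
-- so M ∩ V(H) covers H, and M contains the n + 1 leaves v″ and v_*′; hence |M ∩ V(H)| ≤ k.
module Submission where

open import Defs
open import Data.Nat using (ℕ; suc; _+_; _≤_; z≤n; s≤s; _≤ᵇ_)
open import Data.Nat.Properties
  using (≤ᵇ⇒≤; ≤-refl; m≤n+m; ≤-reflexive; ≤-trans; <⇒≱; +-assoc; +-comm; +-suc; +-monoˡ-≤; +-cancelʳ-≤; module ≤-Reasoning)
open import Data.Fin using (Fin; _≟_)
open import Data.List using (List; []; _∷_; length; tabulate)
open import Data.List.Properties using (length-tabulate; length-removeAt′)
open import Data.List.Membership.Propositional using (_∈_)
open import Data.List.Membership.Propositional.Properties using (∈-tabulate⁻)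
open import Data.List.Relation.Binary.Subset.Propositional using (_⊆_)
open import Data.List.Relation.Unary.Any using (here; there; index; _─_)
open import Data.List.Relation.Unary.All using (lookup)
import Data.List.Relation.Unary.All.Properties as All
open import Data.List.Relation.Unary.AllPairs using ([]; _∷_)
open import Data.List.Relation.Unary.Unique.Propositional using (Unique)
import Data.List.Relation.Unary.Unique.Propositional.Properties as Unique
open import Data.Product using (Σ; ∃-syntax; _×_; _,_)
open import Data.Sum using (_⊎_; inj₁; inj₂; swap) renaming (map to ⊎-map)
open import Data.Unit using (⊤; tt)
open import Data.Empty using (⊥-elim)
open import Data.Bool using (T)
open import Function using (id)
open import Relation.Nullary using (¬_; Dec; yes; no)
open import Relation.Binary.PropositionalEquality using (_≡_; _≢_; refl; sym; trans; cong)

≤-by-evaluation : ∀ {m n} {m≤ᵇn : T (m ≤ᵇ n)} → m ≤ n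
≤-by-evaluation {m} {n} {m≤ᵇn} = ≤ᵇ⇒≤ m n m≤ᵇn

module _ {A : Set} where

  ∈-─ : ∀ {x z : A} {ys} (x∈ys : x ∈ ys) → z ∈ ys → x ≢ z → z ∈ (ys ─ x∈ys)
  ∈-─ (here refl) (here refl)  x≢z = ⊥-elim (x≢z refl)
  ∈-─ (here refl) (there z∈ys) _   = z∈ys
  ∈-─ (there _)   (here refl)  _   = here refl
  ∈-─ (there x∈ys) (there z∈ys) x≢z = there (∈-─ x∈ys z∈ys x≢z)

  unique-⊆⇒length-≤ : {xs ys : List A} → Unique xs → xs ⊆ ys → length xs ≤ length ys
  unique-⊆⇒length-≤ [] _ = z≤n
  unique-⊆⇒length-≤ {x ∷ xs} {ys} (x≢xs ∷ xs-unique) x∷xs⊆ys = begin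
      suc (length xs)          ≤⟨ s≤s (unique-⊆⇒length-≤ xs-unique xs⊆ys─x) ⟩
      suc (length (ys ─ x∈ys)) ≡⟨ sym (length-removeAt′ ys (index x∈ys)) ⟩
      length ys                ∎
    where
      open ≤-Reasoning
      x∈ys : x ∈ ys
      x∈ys = x∷xs⊆ys (here refl)
      xs⊆ys─x : xs ⊆ (ys ─ x∈ys)
      xs⊆ys─x z∈xs = ∈-─ x∈ys (x∷xs⊆ys (there z∈xs)) (lookup x≢xs z∈xs)

module _ {V : Set} {E : V → V → Set} where

  AllSteps : (V → V → Set) → ∀ {x y ℓ} → Walk E x y ℓ → Set
  AllSteps P []                  = ⊤
  AllSteps P (_∷_ {x} {z} _ w)   = P x z × AllSteps P w

  allSteps-onWalk : {P : V → V → Set} → (∀ {s t} → E s t → P s t → P t s) →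
                    ∀ {a b x y ℓ} {w : Walk E x y ℓ} → AllSteps P w → OnWalk a b w → P a b
  allSteps-onWalk _     (p , _)  (here (inj₁ (refl , refl)))         = p
  allSteps-onWalk P-sym (p , _)  (here {e = e} (inj₂ (refl , refl))) = P-sym e p
  allSteps-onWalk P-sym (_ , ps) (there on-w)                          = allSteps-onWalk P-sym ps on-w

  allSteps-map : {P Q : V → V → Set} → (∀ {s t} → E s t → P s t → Q s t) →
                 ∀ {x y ℓ} {w : Walk E x y ℓ} → AllSteps P w → AllSteps Q w
  allSteps-map f {w = []}    _        = tt
  allSteps-map f {w = e ∷ _} (p , ps) = f e p , allSteps-map f ps

  module DistanceLowerBound (d : V → V → ℕ) (d-diag : ∀ x → d x x ≡ 0)
                            (d-step : ∀ {x z} → E x z → ∀ y → d x y ≤ suc (d z y)) where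

    d≤length : ∀ {x y ℓ} → Walk E x y ℓ → d x y ≤ ℓ
    d≤length {x} []           = ≤-reflexive (d-diag x)
    d≤length {y = y} (e ∷ w) = ≤-trans (d-step e y) (s≤s (d≤length w))

    length≡d⇒isShortest : ∀ {x y} (w : Walk E x y (d x y)) → IsShortest w
    length≡d⇒isShortest _ m m<d w′ = <⇒≱ m<d (d≤length w′)

commonNeighbour : ∀ {n} {H : SimpleGraph n} → DiamAtMost2 H → ∀ {a b} →
                  a ≢ b → ¬ Adj H a b → ∃[ c ] Adj H a c × Adj H c b
commonNeighbour diam {a} {b} a≢b ¬ab with diam a b
... | _ , _       , []               = ⊥-elim (a≢b refl)
... | _ , _       , ab ∷ []          = ⊥-elim (¬ab ab)
... | _ , _       , ac ∷ cb ∷ []     = _ , ac , cb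
... | _ , s≤s (s≤s ()) , _ ∷ _ ∷ _ ∷ _

module _ {n : ℕ} where

  nonOrigs : List (GV n) → List (GV n)
  nonOrigs []            = []
  nonOrigs (orig _ ∷ xs) = nonOrigs xs
  nonOrigs (x ∷ xs)      = x ∷ nonOrigs xs

  length-nonOrigs+origs : ∀ xs → length (nonOrigs xs) + length (origs xs) ≡ length xs
  length-nonOrigs+origs []            = refl
  length-nonOrigs+origs (orig _ ∷ xs) = trans (+-suc _ _) (cong suc (length-nonOrigs+origs xs))
  length-nonOrigs+origs (l1 _ ∷ xs)   = cong suc (length-nonOrigs+origs xs)
  length-nonOrigs+origs (l2 _ ∷ xs)   = cong suc (length-nonOrigs+origs xs)
  length-nonOrigs+origs (star ∷ xs)   = cong suc (length-nonOrigs+origs xs)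
  length-nonOrigs+origs (star' ∷ xs)  = cong suc (length-nonOrigs+origs xs)

  nonOrigs-∷ : ∀ {z} y {xs} → z ∈ nonOrigs xs → z ∈ nonOrigs (y ∷ xs)
  nonOrigs-∷ (orig _) z∈ = z∈
  nonOrigs-∷ (l1 _)   z∈ = there z∈
  nonOrigs-∷ (l2 _)   z∈ = there z∈
  nonOrigs-∷ star     z∈ = there z∈
  nonOrigs-∷ star'    z∈ = there z∈

  ∈-nonOrigs : ∀ {x xs} → (∀ a → x ≢ orig a) → x ∈ xs → x ∈ nonOrigs xs
  ∈-nonOrigs {orig a} x≢orig _           = ⊥-elim (x≢orig a refl)
  ∈-nonOrigs {l1 _}   _      (here refl) = here refl
  ∈-nonOrigs {l2 _}   _      (here refl) = here refl
  ∈-nonOrigs {star}   _      (here refl) = here refl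
  ∈-nonOrigs {star'}  _      (here refl) = here refl
  ∈-nonOrigs x≢orig (there {x = y} x∈) = nonOrigs-∷ y (∈-nonOrigs x≢orig x∈)

  orig∈⇒∈origs : ∀ {a} {xs : List (GV n)} → orig a ∈ xs → a ∈ origs xs
  orig∈⇒∈origs (here refl) = here refl
  orig∈⇒∈origs {xs = orig _ ∷ _} (there a∈) = there (orig∈⇒∈origs a∈)
  orig∈⇒∈origs {xs = l1 _ ∷ _}   (there a∈) = orig∈⇒∈origs a∈
  orig∈⇒∈origs {xs = l2 _ ∷ _}   (there a∈) = orig∈⇒∈origs a∈
  orig∈⇒∈origs {xs = star ∷ _}   (there a∈) = orig∈⇒∈origs a∈
  orig∈⇒∈origs {xs = star' ∷ _}  (there a∈) = orig∈⇒∈origs a∈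

  length-origs+≤ : ∀ {S} M → Unique S → S ⊆ nonOrigs M → length (origs M) + length S ≤ length M
  length-origs+≤ {S} M S-unique S⊆nonOrigs = begin
    length (origs M) + length S            ≡⟨ +-comm (length (origs M)) (length S) ⟩
    length S + length (origs M)            ≤⟨ +-monoˡ-≤ _ (unique-⊆⇒length-≤ S-unique S⊆nonOrigs) ⟩
    length (nonOrigs M) + length (origs M) ≡⟨ length-nonOrigs+origs M ⟩
    length M                               ∎
    where open ≤-Reasoning

module Construction {n : ℕ} (H : SimpleGraph n) where

  E : GV n → GV n → Set
  E = GAdj H

  -- The distance in H (of diameter at most 2), as a function of the two decisions so that
  -- matching on them computes the lengths of the walks built below.
  δ-of : ∀ {a b : Fin n} → Dec (a ≡ b) → Dec (Adj H a b) → ℕ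
  δ-of (yes _) _       = 0
  δ-of (no _)  (yes _) = 1
  δ-of (no _)  (no _)  = 2

  apart : ∀ {a b : Fin n} → Dec (a ≡ b) → ℕ → ℕ
  apart (yes _) _ = 0
  apart (no _)  k = k

  δ : Fin n → Fin n → ℕ
  δ a b = δ-of (a ≟ b) (Adj-dec H a b)

  d : GV n → GV n → ℕ
  d (orig a) (orig b) = δ a b
  d (orig a) (l1 b)   = suc (δ a b)
  d (orig a) (l2 b)   = suc (suc (δ a b))
  d (orig _) star     = 2
  d (orig _) star'    = 3
  d (l1 a)   (orig b) = suc (δ a b)
  d (l1 a)   (l1 b)   = apart (a ≟ b) 2
  d (l1 a)   (l2 b)   = suc (apart (a ≟ b) 2)
  d (l1 _)   star     = 1
  d (l1 _)   star'    = 2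
  d (l2 a)   (orig b) = suc (suc (δ a b))
  d (l2 a)   (l1 b)   = suc (apart (a ≟ b) 2)
  d (l2 a)   (l2 b)   = apart (a ≟ b) 4
  d (l2 _)   star     = 2
  d (l2 _)   star'    = 3
  d star     (orig _) = 2
  d star     (l1 _)   = 1
  d star     (l2 _)   = 2
  d star     star     = 0
  d star     star'    = 1
  d star'    (orig _) = 3
  d star'    (l1 _)   = 2
  d star'    (l2 _)   = 3
  d star'    star     = 1
  d star'    star'    = 0

  δ-of≤2 : ∀ {a b : Fin n} (p : Dec (a ≡ b)) (q : Dec (Adj H a b)) → δ-of p q ≤ 2
  δ-of≤2 (yes _) _       = z≤n
  δ-of≤2 (no _)  (yes _) = ≤-by-evaluation
  δ-of≤2 (no _)  (no _)  = ≤-refl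

  δ-of≤apart : ∀ {a b : Fin n} (p : Dec (a ≡ b)) (q : Dec (Adj H a b)) → δ-of p q ≤ apart p 2
  δ-of≤apart (yes _)    _ = z≤n
  δ-of≤apart (no a≢b) q = δ-of≤2 (no a≢b) q

  apart≤2+δ-of : ∀ {a b : Fin n} (p : Dec (a ≡ b)) (q : Dec (Adj H a b)) → apart p 2 ≤ 2 + δ-of p q
  apart≤2+δ-of (yes _) _ = z≤n
  apart≤2+δ-of (no _)  _ = s≤s (s≤s z≤n)

  apart≤ : ∀ {a b : Fin n} (p : Dec (a ≡ b)) k → apart p k ≤ k
  apart≤ (yes _) _ = z≤n
  apart≤ (no _)  _ = ≤-refl

  apart-mono : ∀ {a b : Fin n} (p : Dec (a ≡ b)) {k m} → k ≤ m → apart p k ≤ apart p m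
  apart-mono (yes _) _   = z≤n
  apart-mono (no _)  k≤m = k≤m

  apart-2+ : ∀ {a b : Fin n} (p : Dec (a ≡ b)) k → apart p (2 + k) ≤ 2 + apart p k
  apart-2+ (yes _) _ = z≤n
  apart-2+ (no _)  _ = ≤-refl

  δ-of-step : ∀ {a b c : Fin n} → Adj H a c →
              (p : Dec (a ≡ b)) (q : Dec (Adj H a b)) (p′ : Dec (c ≡ b)) (q′ : Dec (Adj H c b)) →
              δ-of p q ≤ suc (δ-of p′ q′)
  δ-of-step _  (yes _)    _       _          _       = z≤n
  δ-of-step _  (no _)     (yes _) (yes refl) _       = ≤-by-evaluation
  δ-of-step ac (no _)     (no ¬ab) (yes refl) _      = ⊥-elim (¬ab ac)
  δ-of-step _  (no a≢b)   q       (no _)     (yes _) = δ-of≤2 (no a≢b) q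
  δ-of-step _  (no a≢b)   q       (no _)     (no _)  = ≤-trans (δ-of≤2 (no a≢b) q) ≤-by-evaluation

  δ-step : ∀ {a c} → Adj H a c → ∀ b → δ a b ≤ suc (δ c b)
  δ-step {a} {c} ac b = δ-of-step ac (a ≟ b) (Adj-dec H a b) (c ≟ b) (Adj-dec H c b)

  δ-of-refl : ∀ {a : Fin n} (p : Dec (a ≡ a)) (q : Dec (Adj H a a)) → δ-of p q ≡ 0
  δ-of-refl (yes _)  _ = refl
  δ-of-refl (no a≢a) _ = ⊥-elim (a≢a refl)

  apart-refl : ∀ {a : Fin n} (p : Dec (a ≡ a)) k → apart p k ≡ 0
  apart-refl (yes _)  _ = refl
  apart-refl (no a≢a) _ = ⊥-elim (a≢a refl)

  d-diag : ∀ x → d x x ≡ 0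
  d-diag (orig a) = δ-of-refl (a ≟ a) (Adj-dec H a a)
  d-diag (l1 a)   = apart-refl (a ≟ a) 2
  d-diag (l2 a)   = apart-refl (a ≟ a) 4
  d-diag star     = refl
  d-diag star'    = refl

  d-step-orig : ∀ {x z} → E x z → ∀ b → d x (orig b) ≤ suc (d z (orig b))
  d-step-orig (h-h ac)    b = δ-step ac b
  d-step-orig h-l1        b = m≤n+m _ 2
  d-step-orig l1-h        b = ≤-refl
  d-step-orig l1-l2       b = s≤s (m≤n+m _ 2)
  d-step-orig l2-l1       b = ≤-refl
  d-step-orig star-star'  b = ≤-by-evaluation
  d-step-orig star'-star  b = ≤-refl
  d-step-orig star-l1     b = s≤s (s≤s z≤n)
  d-step-orig (l1-star {a}) b = s≤s (δ-of≤2 (a ≟ b) (Adj-dec H a b))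

  d-step-l1 : ∀ {x z} → E x z → ∀ b → d x (l1 b) ≤ suc (d z (l1 b))
  d-step-l1 (h-h ac)      b = s≤s (δ-step ac b)
  d-step-l1 (h-l1 {a})    b = s≤s (δ-of≤apart (a ≟ b) (Adj-dec H a b))
  d-step-l1 (l1-h {a})    b = apart≤2+δ-of (a ≟ b) (Adj-dec H a b)
  d-step-l1 l1-l2         b = m≤n+m _ 2
  d-step-l1 l2-l1         b = ≤-refl
  d-step-l1 star-star'    b = ≤-by-evaluation
  d-step-l1 star'-star    b = ≤-refl
  d-step-l1 star-l1       b = s≤s z≤n
  d-step-l1 (l1-star {a}) b = apart≤ (a ≟ b) 2

  d-step-l2 : ∀ {x z} → E x z → ∀ b → d x (l2 b) ≤ suc (d z (l2 b))
  d-step-l2 (h-h ac)      b = s≤s (s≤s (δ-step ac b))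
  d-step-l2 (h-l1 {a})    b = s≤s (s≤s (δ-of≤apart (a ≟ b) (Adj-dec H a b)))
  d-step-l2 (l1-h {a})    b = s≤s (apart≤2+δ-of (a ≟ b) (Adj-dec H a b))
  d-step-l2 (l1-l2 {a})   b = s≤s (apart-mono (a ≟ b) ≤-by-evaluation)
  d-step-l2 (l2-l1 {a})   b = apart-2+ (a ≟ b) 2
  d-step-l2 star-star'    b = ≤-by-evaluation
  d-step-l2 star'-star    b = ≤-refl
  d-step-l2 star-l1       b = s≤s (s≤s z≤n)
  d-step-l2 (l1-star {a}) b = s≤s (apart≤ (a ≟ b) 2)

  d-step-star : ∀ {x z} → E x z → d x star ≤ suc (d z star)
  d-step-star (h-h _)    = ≤-by-evaluation
  d-step-star h-l1       = ≤-by-evaluation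
  d-step-star l1-h       = ≤-by-evaluation
  d-step-star l1-l2      = ≤-by-evaluation
  d-step-star l2-l1      = ≤-by-evaluation
  d-step-star star-star' = ≤-by-evaluation
  d-step-star star'-star = ≤-by-evaluation
  d-step-star star-l1    = ≤-by-evaluation
  d-step-star l1-star    = ≤-by-evaluation

  d-step-star' : ∀ {x z} → E x z → d x star' ≤ suc (d z star')
  d-step-star' (h-h _)    = ≤-by-evaluation
  d-step-star' h-l1       = ≤-by-evaluation
  d-step-star' l1-h       = ≤-by-evaluation
  d-step-star' l1-l2      = ≤-by-evaluation
  d-step-star' l2-l1      = ≤-by-evaluation
  d-step-star' star-star' = ≤-by-evaluation
  d-step-star' star'-star = ≤-by-evaluation
  d-step-star' star-l1    = ≤-by-evaluation
  d-step-star' l1-star    = ≤-by-evaluation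

  d-step : ∀ {x z} → E x z → ∀ y → d x y ≤ suc (d z y)
  d-step e (orig b) = d-step-orig e b
  d-step e (l1 b)   = d-step-l1 e b
  d-step e (l2 b)   = d-step-l2 e b
  d-step e star     = d-step-star e
  d-step e star'    = d-step-star' e

  open DistanceLowerBound {E = E} d d-diag d-step

  Guarded : List (GV n) → GV n → GV n → Set
  Guarded S (orig p) (orig q) = orig p ∈ S ⊎ orig q ∈ S
  Guarded S (l1 _)   (l2 q)   = l2 q ∈ S
  Guarded S (l2 p)   (l1 _)   = l2 p ∈ S
  Guarded S star     star'    = star' ∈ S
  Guarded S star'    star     = star' ∈ S
  Guarded _ _        _        = ⊤

  guarded-sym : ∀ {S s t} → E s t → Guarded S s t → Guarded S t s
  guarded-sym (h-h _)    = swap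
  guarded-sym h-l1       = λ _ → tt
  guarded-sym l1-h       = λ _ → tt
  guarded-sym l1-l2      = id
  guarded-sym l2-l1      = id
  guarded-sym star-star' = id
  guarded-sym star'-star = id
  guarded-sym star-l1    = λ _ → tt
  guarded-sym l1-star    = λ _ → tt

  guarded-⊆ : ∀ {S T s t} → S ⊆ T → E s t → Guarded S s t → Guarded T s t
  guarded-⊆ S⊆T (h-h _)    = ⊎-map S⊆T S⊆T
  guarded-⊆ S⊆T h-l1       = λ _ → tt
  guarded-⊆ S⊆T l1-h       = λ _ → tt
  guarded-⊆ S⊆T l1-l2      = S⊆T
  guarded-⊆ S⊆T l2-l1      = S⊆T
  guarded-⊆ S⊆T star-star' = S⊆T
  guarded-⊆ S⊆T star'-star = S⊆T
  guarded-⊆ S⊆T star-l1    = λ _ → tt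
  guarded-⊆ S⊆T l1-star    = λ _ → tt

  GuardedWalk : List (GV n) → GV n → GV n → ℕ → Set
  GuardedWalk S x y ℓ = Σ (Walk E x y ℓ) (AllSteps (Guarded S))

  widen : ∀ {S T x y ℓ} → S ⊆ T → GuardedWalk S x y ℓ → GuardedWalk T x y ℓ
  widen S⊆T (w , guarded) = w , allSteps-map (guarded-⊆ S⊆T) guarded

  prepend : ∀ {x h y ℓ} (e : E x h) → Guarded (x ∷ y ∷ []) x h →
            GuardedWalk (y ∷ []) h y ℓ → GuardedWalk (x ∷ y ∷ []) x y (suc ℓ)
  prepend e e-guarded (w , guarded) = e ∷ w , e-guarded , allSteps-map (guarded-⊆ there) guarded

  fromL1-orig : ∀ {a b} (p : Dec (a ≡ b)) (q : Dec (Adj H a b)) →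
                GuardedWalk (orig b ∷ []) (l1 a) (orig b) (suc (δ-of p q))
  fromL1-orig (yes refl) _       = l1-h ∷ [] , _
  fromL1-orig (no _)     (yes ab) = l1-h ∷ h-h ab ∷ [] , tt , inj₂ (here refl) , tt
  fromL1-orig (no _)     (no _)   = l1-star ∷ star-l1 ∷ l1-h ∷ [] , _

  fromL1-l1 : ∀ {a b} (p : Dec (a ≡ b)) → GuardedWalk (l1 b ∷ []) (l1 a) (l1 b) (apart p 2)
  fromL1-l1 (yes refl) = [] , _
  fromL1-l1 (no _)     = l1-star ∷ star-l1 ∷ [] , _

  fromL1-l2 : ∀ {a b} (p : Dec (a ≡ b)) → GuardedWalk (l2 b ∷ []) (l1 a) (l2 b) (suc (apart p 2))
  fromL1-l2 (yes refl) = l1-l2 ∷ [] , here refl , tt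
  fromL1-l2 (no _)     = l1-star ∷ star-l1 ∷ l1-l2 ∷ [] , tt , tt , here refl , tt

  -- Shortest walks leaving v′ or v_* never need their starting vertex as a guard.
  fromL1 : ∀ a y → GuardedWalk (y ∷ []) (l1 a) y (d (l1 a) y)
  fromL1 a (orig b) = fromL1-orig (a ≟ b) (Adj-dec H a b)
  fromL1 a (l1 b)   = fromL1-l1 (a ≟ b)
  fromL1 a (l2 b)   = fromL1-l2 (a ≟ b)
  fromL1 a star     = l1-star ∷ [] , _
  fromL1 a star'    = l1-star ∷ star-star' ∷ [] , tt , here refl , tt

  fromStar : ∀ y → GuardedWalk (y ∷ []) star y (d star y)
  fromStar (orig b) = star-l1 ∷ l1-h ∷ [] , _
  fromStar (l1 b)   = star-l1 ∷ [] , _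
  fromStar (l2 b)   = star-l1 ∷ l1-l2 ∷ [] , tt , here refl , tt
  fromStar star     = [] , _
  fromStar star'    = star-star' ∷ [] , here refl , tt

  fromL2-l2 : ∀ {a b} (p : Dec (a ≡ b)) → GuardedWalk (l2 a ∷ l2 b ∷ []) (l2 a) (l2 b) (apart p 4)
  fromL2-l2 (yes refl) = [] , _
  fromL2-l2 (no _)     = l2-l1 ∷ l1-star ∷ star-l1 ∷ l1-l2 ∷ [] , here refl , tt , tt , there (here refl) , tt

  fromOrig-l1 : ∀ {a b} (p : Dec (a ≡ b)) (q : Dec (Adj H a b)) →
                GuardedWalk (orig a ∷ l1 b ∷ []) (orig a) (l1 b) (suc (δ-of p q))
  fromOrig-l1 (yes refl) _       = h-l1 ∷ [] , _
  fromOrig-l1 (no _)     (yes ab) = h-h ab ∷ h-l1 ∷ [] , inj₁ (here refl) , _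
  fromOrig-l1 (no _)     (no _)   = h-l1 ∷ l1-star ∷ star-l1 ∷ [] , _

  fromOrig-l2 : ∀ {a b} (p : Dec (a ≡ b)) (q : Dec (Adj H a b)) →
                GuardedWalk (orig a ∷ l2 b ∷ []) (orig a) (l2 b) (suc (suc (δ-of p q)))
  fromOrig-l2 (yes refl) _       = h-l1 ∷ l1-l2 ∷ [] , tt , there (here refl) , tt
  fromOrig-l2 (no _)     (yes ab) =
    h-h ab ∷ h-l1 ∷ l1-l2 ∷ [] , inj₁ (here refl) , tt , there (here refl) , tt
  fromOrig-l2 (no _)     (no _)   =
    h-l1 ∷ l1-star ∷ star-l1 ∷ l1-l2 ∷ [] , tt , tt , tt , there (here refl) , tt

  module _ (diam : DiamAtMost2 H) where

    fromOrig-orig : ∀ {a b} (p : Dec (a ≡ b)) (q : Dec (Adj H a b)) →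
                    GuardedWalk (orig a ∷ orig b ∷ []) (orig a) (orig b) (δ-of p q)
    fromOrig-orig (yes refl) _ = [] , _
    fromOrig-orig (no _)     (yes ab) = h-h ab ∷ [] , inj₁ (here refl) , tt
    fromOrig-orig (no a≢b)   (no ¬ab) with commonNeighbour {H = H} diam a≢b ¬ab
    ... | _ , ac , cb = h-h ac ∷ h-h cb ∷ [] , inj₁ (here refl) , inj₂ (there (here refl)) , tt

    route : ∀ x y → GuardedWalk (x ∷ y ∷ []) x y (d x y)
    route (orig a) (orig b) = fromOrig-orig (a ≟ b) (Adj-dec H a b)
    route (orig a) (l1 b)   = fromOrig-l1 (a ≟ b) (Adj-dec H a b)
    route (orig a) (l2 b)   = fromOrig-l2 (a ≟ b) (Adj-dec H a b)
    route (orig a) star     = prepend h-l1 tt (fromL1 a star)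
    route (orig a) star'    = prepend h-l1 tt (fromL1 a star')
    route (l1 a)   y        = widen there (fromL1 a y)
    route (l2 a)   (orig b) = prepend l2-l1 (here refl) (fromL1 a (orig b))
    route (l2 a)   (l1 b)   = prepend l2-l1 (here refl) (fromL1 a (l1 b))
    route (l2 a)   (l2 b)   = fromL2-l2 (a ≟ b)
    route (l2 a)   star     = prepend l2-l1 (here refl) (fromL1 a star)
    route (l2 a)   star'    = prepend l2-l1 (here refl) (fromL1 a star')
    route star     y        = widen there (fromStar y)
    route star'    (orig b) = prepend star'-star (here refl) (fromStar (orig b))
    route star'    (l1 b)   = prepend star'-star (here refl) (fromStar (l1 b))
    route star'    (l2 b)   = prepend star'-star (here refl) (fromStar (l2 b))
    route star'    star     = prepend star'-star (here refl) (fromStar star)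
    route star'    star'    = [] , _

    monitors⇒guarded : ∀ {x y a b} → Monitors E x y a b → Guarded (x ∷ y ∷ []) a b
    monitors⇒guarded {x} {y} monitors =
      let (w , guarded) = route x y
      in allSteps-onWalk guarded-sym guarded (monitors _ w (length≡d⇒isShortest w))

    isMEG⇒guarded : ∀ {M a b} → IsMEG E M → E a b → Guarded M a b
    isMEG⇒guarded {M} {a} {b} isMEG e with isMEG a b e
    ... | x , y , x∈M , y∈M , monitors = guarded-⊆ pair⊆M e (monitors⇒guarded monitors)
      where
        pair⊆M : (x ∷ y ∷ []) ⊆ M
        pair⊆M (here refl)         = x∈M
        pair⊆M (there (here refl)) = y∈M

    isMEG⇒length-origs+n+1≤ : ∀ {M} → IsMEG E M → length (origs M) + suc n ≤ length M
    isMEG⇒length-origs+n+1≤ {M} isMEG = begin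
      length (origs M) + suc n         ≡⟨ cong (λ m → length (origs M) + suc m) (sym (length-tabulate l2)) ⟩
      length (origs M) + length leaves ≤⟨ length-origs+≤ M leaves-unique leaves⊆nonOrigs ⟩
      length M                         ∎
      where
        open ≤-Reasoning
        leaves : List (GV n)
        leaves = star' ∷ tabulate l2

        leaves-unique : Unique leaves
        leaves-unique = All.tabulate⁺ (λ _ ()) ∷ Unique.tabulate⁺ λ { refl → refl }

        leaves⊆nonOrigs : leaves ⊆ nonOrigs M
        leaves⊆nonOrigs (here refl) = ∈-nonOrigs (λ _ ()) (isMEG⇒guarded isMEG star'-star)
        leaves⊆nonOrigs (there l∈) with ∈-tabulate⁻ l∈
        ... | _ , refl = ∈-nonOrigs (λ _ ()) (isMEG⇒guarded isMEG l2-l1)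

lemma4 : (n : ℕ) → (H : SimpleGraph n) → 2 ≤ n → DiamAtMost2 H →
         (k : ℕ) → (M : List (GV n)) → Unique M →
         IsMEG (GAdj H) M → length M ≡ k + n + 1 →
         (∀ u v → Adj H u v → u ∈ origs M ⊎ v ∈ origs M) × length (origs M) ≤ k
lemma4 n H _ diam k M _ isMEG |M|≡k+n+1 = cover , +-cancelʳ-≤ (suc n) (length (origs M)) k size
  where
    open Construction H

    cover : ∀ u v → Adj H u v → u ∈ origs M ⊎ v ∈ origs M
    cover u v uv = ⊎-map orig∈⇒∈origs orig∈⇒∈origs (isMEG⇒guarded diam isMEG (h-h uv))

    size : length (origs M) + suc n ≤ k + suc n
    size = begin
      length (origs M) + suc n ≤⟨ isMEG⇒length-origs+n+1≤ diam isMEG ⟩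
      length M                 ≡⟨ |M|≡k+n+1 ⟩
      k + n + 1                ≡⟨ +-assoc k n 1 ⟩
      k + (n + 1)              ≡⟨ cong (k +_) (+-comm n 1) ⟩
      k + suc n                ∎
      where open ≤-Reasoning
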